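{- For all $n\ge0$, the number of edges of the parity-constrained Hanoi graph $P^n$ is \[ |E(P^n)|=\begin{cases}\dfrac{3^{n+3}-20\cdot 2^{n/2}-7}{14}, & n\text{ even},\\[6pt] \dfrac{3^{n+3}-32\cdot2^{(n-1)/2}-7}{14}, & n\text{ odd}.\end{cases} \]
   Context: Let $Q=\{0,1,2,3\}$ (pegs: $0,3$ neutral; $1$ reserved for even discs; $2$ reserved for odd discs). For a disc $d\in\{1,\dots,n\}$ let $p(d)=1$ if $d$ is even and $p(d)=2$ if $d$ is odd, and $Q^d=\{0,p(d),3\}$. The vertices of $P^n$ are words $s=s_n\cdots s_1\in Q^n$ ($s_d$ is the peg of disc $d$) with $s_d\in Q^d$ for all $d$. Two vertices are adjacent iff they differ in exactly one coordinate $d$, with values $i\ne j$ there, $i,j\in Q^d$, and $s_k\notin\{i,j\}$ for all $k<d$. $P^0$ is the graph with one vertex. -}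

module Defs where

open import Data.Nat using (ℕ; zero; suc)
open import Data.Bool using (Bool; true; false; _∧_; _∨_; not; if_then_else_)
open import Data.Fin using (Fin; zero; suc) renaming (_≟_ to _≟ᶠ_; _<?_ to _<?ᶠ_)
open import Data.Vec using (Vec; []; _∷_)
open import Data.List using (List; []; _∷_; filter; length; concatMap; map; cartesianProduct)
open import Data.Product using (_×_; _,_)
open import Relation.Nullary.Decidable using (⌊_⌋)

Peg : Set
Peg = Fin 4

_==_ : Peg → Peg → Bool
a == b = ⌊ a ≟ᶠ b ⌋

_<ᵇ_ : Peg → Peg → Bool
a <ᵇ b = ⌊ a <?ᶠ b ⌋

isEven : ℕ → Bool
isEven zero = true
isEven (suc n) = not (isEven n)

p : ℕ → Peg
p d = if isEven d then suc zero else suc (suc zero)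

allowed : ℕ → Peg → Bool
allowed d q = (q == zero) ∨ (q == p d) ∨ (q == suc (suc (suc zero)))

-- A word s = s_n ⋯ s_1 is a vector of length n whose HEAD is s_n
-- (the peg of the largest disc n) and whose last entry is s_1.
Word : ℕ → Set
Word n = Vec Peg n

valid : ∀ {n} → Word n → Bool
valid [] = true
valid {suc n} (q ∷ w) = allowed (suc n) q ∧ valid w

allWords : (n : ℕ) → List (Word n)
allWords zero = [] ∷ []
allWords (suc n) =
  concatMap (λ q → map (q ∷_) (allWords n))
    (zero ∷ suc zero ∷ suc (suc zero) ∷ suc (suc (suc zero)) ∷ [])

vertices : (n : ℕ) → List (Word n)
vertices n = filter (λ w → valid w Data.Bool.≟ true) (allWords n)

wordEq : ∀ {n} → Word n → Word n → Bool
wordEq [] [] = true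
wordEq (a ∷ s) (b ∷ t) = (a == b) ∧ wordEq s t

avoids : ∀ {n} → Peg → Peg → Word n → Bool
avoids i j [] = true
avoids i j (q ∷ w) = not (q == i) ∧ not (q == j) ∧ avoids i j w

-- Oriented adjacency: s and t differ in exactly one coordinate d,
-- with s_d = i, t_d = j, i < j (a canonical orientation of the unordered
-- edge {s,t}), i, j ∈ Q^d, and s_k ∉ {i,j} for all k < d.
arc : ∀ {n} → Word n → Word n → Bool
arc [] [] = false
arc {suc n} (a ∷ s) (b ∷ t) =
  if a == b then arc s t
  else ((a <ᵇ b) ∧ allowed (suc n) a ∧ allowed (suc n) b ∧ wordEq s t ∧ avoids a b s)

-- Number of edges of P^n: unordered adjacent pairs {s,t}, each counted once
-- via the orientation s_d < t_d at the unique differing coordinate d.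
edgeCount : ℕ → ℕ
edgeCount n =
  length (filter (λ { (s , t) → arc s t Data.Bool.≟ true })
                 (cartesianProduct (vertices n) (vertices n)))

-- Fix the peg q ∈ Q^(n+1) of the largest disc: the vertices q·s form a copy of P^n, and
-- P^(n+1) is three such copies plus, for each pair i < j in Q^(n+1), one edge per vertex
-- s of P^n avoiding i and j (disc n+1 moves from i to j over the smaller discs).  Writing
-- a_n(i,j) for the number of such s and r for the reserved peg of disc n+1,
--   |E(P^(n+1))| = 3|E(P^n)| + a_n(0,r) + a_n(0,3) + a_n(r,3),
--   a_(n+1)(i,j) = |Q^(n+1) ∖ {i,j}| · a_n(i,j).
-- So a_n(0,3) = 1, a_n(0,1) = a_n(1,3) = 2^⌈n/2⌉ and a_n(0,2) = a_n(2,3) = 2^⌊n/2⌋, and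
-- two steps of the recursion (an odd, then an even disc) turn 14|E| + c + 7 = 3^(n+3) into
-- the same identity at n + 2 with the correction term c doubling.

module Submission where

open import Defs
open import Data.Bool using (Bool; true; false; _∧_; _∨_; not; if_then_else_) renaming (_≟_ to _≟ᵇ_)
open import Data.Bool.Properties using (∧-assoc; not-involutive)
open import Data.Fin using (zero; suc)
open import Data.List using (List; []; _∷_; _++_; map; concatMap; filter; length; cartesianProduct)
open import Data.Nat using (ℕ; zero; suc; _+_; _*_; _^_)
open import Data.Nat.Properties using (+-assoc; +-identityʳ; *-identityˡ; *-suc; +-comm)
open import Data.Nat.Tactic.RingSolver using (solve-∀)
open import Data.Product using (_×_; _,_)
open import Data.Sum using (_⊎_; inj₁; inj₂)
open import Data.Vec using ([]; _∷_)
open import Relation.Binary.PropositionalEquality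
open import Relation.Nullary using (does)
open import Relation.Unary using (Pred; Decidable)

pattern P0 = zero
pattern P1 = suc zero
pattern P2 = suc (suc zero)
pattern P3 = suc (suc (suc zero))

when : Bool → ℕ → ℕ
when true  x = x
when false x = 0

𝟙 : Bool → ℕ
𝟙 b = when b 1

when-∧ : ∀ a b x → when (a ∧ b) x ≡ when a (when b x)
when-∧ true  b x = refl
when-∧ false b x = refl

when-∧₃ : ∀ a b c x → when (a ∧ b ∧ c) x ≡ when a (when b (when c x))
when-∧₃ true  b c x = when-∧ b c x
when-∧₃ false b c x = refl

when-comm : ∀ a b x → when a (when b x) ≡ when b (when a x)
when-comm true  b     x = refl
when-comm false true  x = refl
when-comm false false x = refl

when-idem : ∀ b x → when b (when b x) ≡ when b x
when-idem true  x = refl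
when-idem false x = refl

when≡𝟙* : ∀ b x → when b x ≡ 𝟙 b * x
when≡𝟙* true  x = sym (*-identityˡ x)
when≡𝟙* false x = refl

does-≟-true : ∀ b → does (b ≟ᵇ true) ≡ b
does-≟-true true  = refl
does-≟-true false = refl

private variable
  A B : Set

∑ : List A → (A → ℕ) → ℕ
∑ []       f = 0
∑ (x ∷ xs) f = f x + ∑ xs f

syntax ∑ xs (λ x → e) = ∑[ x ∈ xs ] e

∑-cong : ∀ xs {f g : A → ℕ} → (∀ x → f x ≡ g x) → ∑ xs f ≡ ∑ xs g
∑-cong []       f≗g = refl
∑-cong (x ∷ xs) f≗g = cong₂ _+_ (f≗g x) (∑-cong xs f≗g)

∑-++ : ∀ xs ys (f : A → ℕ) → ∑ (xs ++ ys) f ≡ ∑ xs f + ∑ ys f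
∑-++ []       ys f = refl
∑-++ (x ∷ xs) ys f = trans (cong (f x +_) (∑-++ xs ys f)) (sym (+-assoc (f x) _ _))

∑-zero : ∀ (xs : List A) → ∑[ x ∈ xs ] 0 ≡ 0
∑-zero []       = refl
∑-zero (x ∷ xs) = ∑-zero xs

∑-when : ∀ (xs : List A) b (f : A → ℕ) → ∑[ x ∈ xs ] when b (f x) ≡ when b (∑ xs f)
∑-when xs true  f = refl
∑-when xs false f = ∑-zero xs

∑-filter : ∀ {ℓ} {P : Pred A ℓ} (P? : Decidable P) xs (f : A → ℕ) →
  ∑ (filter P? xs) f ≡ ∑[ x ∈ xs ] when (does (P? x)) (f x)
∑-filter P? []       f = refl
∑-filter P? (x ∷ xs) f with does (P? x)
... | true  = cong (f x +_) (∑-filter P? xs f)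
... | false = ∑-filter P? xs f

length≡∑ : ∀ (xs : List A) → length xs ≡ ∑[ x ∈ xs ] 1
length≡∑ []       = refl
length≡∑ (x ∷ xs) = cong suc (length≡∑ xs)

∑-map : ∀ (g : A → B) xs (f : B → ℕ) → ∑ (map g xs) f ≡ ∑[ x ∈ xs ] f (g x)
∑-map g []       f = refl
∑-map g (x ∷ xs) f = cong (f (g x) +_) (∑-map g xs f)

∑-concatMap : ∀ (g : A → List B) xs (f : B → ℕ) →
  ∑ (concatMap g xs) f ≡ ∑[ x ∈ xs ] ∑ (g x) f
∑-concatMap g []       f = refl
∑-concatMap g (x ∷ xs) f =
  trans (∑-++ (g x) _ f) (cong (∑ (g x) f +_) (∑-concatMap g xs f))

∑-cartesianProduct : ∀ xs ys (f : A × B → ℕ) →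
  ∑ (cartesianProduct xs ys) f ≡ ∑[ x ∈ xs ] ∑[ y ∈ ys ] f (x , y)
∑-cartesianProduct []       ys f = refl
∑-cartesianProduct (x ∷ xs) ys f =
  trans (∑-++ (map (x ,_) ys) _ f) (cong₂ _+_ (∑-map (x ,_) ys f) (∑-cartesianProduct xs ys f))

∑ᴾ : (Peg → ℕ) → ℕ
∑ᴾ f = f P0 + (f P1 + (f P2 + f P3))

∑ᴾ-cong : ∀ {f g : Peg → ℕ} → (∀ q → f q ≡ g q) → ∑ᴾ f ≡ ∑ᴾ g
∑ᴾ-cong f≗g = cong₂ _+_ (f≗g P0) (cong₂ _+_ (f≗g P1) (cong₂ _+_ (f≗g P2) (f≗g P3)))

∑ᴾ-pick : ∀ a (f : Peg → ℕ) → ∑ᴾ (λ q → when (a == q) (f q)) ≡ f a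
∑ᴾ-pick P0 f = +-identityʳ (f P0)
∑ᴾ-pick P1 f = +-identityʳ (f P1)
∑ᴾ-pick P2 f = +-identityʳ (f P2)
∑ᴾ-pick P3 f = refl

∑ᴾ-when-const : ∀ (b : Peg → Bool) x → ∑ᴾ (λ q → when (b q) x) ≡ ∑ᴾ (λ q → 𝟙 (b q)) * x
∑ᴾ-when-const b x =
  trans (∑ᴾ-cong (λ q → when≡𝟙* (b q) x)) (distrib (𝟙 (b P0)) (𝟙 (b P1)) (𝟙 (b P2)) (𝟙 (b P3)) x)
  where
  distrib : ∀ a b c d x → a * x + (b * x + (c * x + d * x)) ≡ (a + (b + (c + d))) * x
  distrib = solve-∀

∑-∑ᴾ : ∀ (xs : List A) (f : A → Peg → ℕ) → ∑[ x ∈ xs ] ∑ᴾ (f x) ≡ ∑ᴾ λ q → ∑[ x ∈ xs ] f x q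
∑-∑ᴾ []       f = refl
∑-∑ᴾ (x ∷ xs) f = trans (cong (∑ᴾ (f x) +_) (∑-∑ᴾ xs f))
                         (interchange (f x P0) (f x P1) (f x P2) (f x P3) (g P0) (g P1) (g P2) (g P3))
  where
  g : Peg → ℕ
  g q = ∑[ y ∈ xs ] f y q
  interchange : ∀ a b c d a' b' c' d' →
    a + (b + (c + d)) + (a' + (b' + (c' + d'))) ≡ (a + a') + ((b + b') + ((c + c') + (d + d')))
  interchange = solve-∀

∑-allWords-suc : ∀ n (f : Word (suc n) → ℕ) →
  ∑ (allWords (suc n)) f ≡ ∑ᴾ λ q → ∑[ w ∈ allWords n ] f (q ∷ w)
∑-allWords-suc n f =
  trans (∑-concatMap (λ q → map (q ∷_) ws) (P0 ∷ P1 ∷ P2 ∷ P3 ∷ []) f)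
        (cong₂ _+_ (∑-map (P0 ∷_) ws f) (cong₂ _+_ (∑-map (P1 ∷_) ws f) (cong₂ _+_ (∑-map (P2 ∷_) ws f)
          (trans (+-identityʳ _) (∑-map (P3 ∷_) ws f)))))
  where
  ws : List (Word n)
  ws = allWords n

∑-wordEq : ∀ n (s : Word n) (f : Word n → ℕ) → ∑[ t ∈ allWords n ] when (wordEq s t) (f t) ≡ f s
∑-wordEq zero    []      f = +-identityʳ (f [])
∑-wordEq (suc n) (a ∷ s) f = begin
  ∑[ t ∈ allWords (suc n) ] when (wordEq (a ∷ s) t) (f t)
    ≡⟨ ∑-allWords-suc n _ ⟩
  ∑ᴾ (λ q → ∑[ w ∈ allWords n ] when ((a == q) ∧ wordEq s w) (f (q ∷ w)))
    ≡⟨ ∑ᴾ-cong (λ q → trans (∑-cong (allWords n) (λ w → when-∧ (a == q) (wordEq s w) (f (q ∷ w))))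
                            (∑-when (allWords n) (a == q) (λ w → when (wordEq s w) (f (q ∷ w))))) ⟩
  ∑ᴾ (λ q → when (a == q) (∑[ w ∈ allWords n ] when (wordEq s w) (f (q ∷ w))))
    ≡⟨ ∑ᴾ-cong (λ q → cong (when (a == q)) (∑-wordEq n s (λ w → f (q ∷ w)))) ⟩
  ∑ᴾ (λ q → when (a == q) (f (q ∷ s)))
    ≡⟨ ∑ᴾ-pick a (λ q → f (q ∷ s)) ⟩
  f (a ∷ s) ∎
  where open ≡-Reasoning

Σᵛ : ∀ n → (Word n → ℕ) → ℕ
Σᵛ n f = ∑[ s ∈ allWords n ] when (valid s) (f s)

Σᵛ-cong : ∀ n {f g : Word n → ℕ} → (∀ s → f s ≡ g s) → Σᵛ n f ≡ Σᵛ n g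
Σᵛ-cong n f≗g = ∑-cong (allWords n) (λ s → cong (when (valid s)) (f≗g s))

Σᵛ-when : ∀ n b (f : Word n → ℕ) → Σᵛ n (λ s → when b (f s)) ≡ when b (Σᵛ n f)
Σᵛ-when n b f =
  trans (∑-cong (allWords n) (λ s → when-comm (valid s) b (f s))) (∑-when (allWords n) b _)

Σᵛ-∑ᴾ : ∀ n (f : Word n → Peg → ℕ) → Σᵛ n (λ s → ∑ᴾ (f s)) ≡ ∑ᴾ λ q → Σᵛ n (λ s → f s q)
Σᵛ-∑ᴾ n f = trans (∑-cong (allWords n) (λ s → when-∑ᴾ (valid s) (f s)))
                  (∑-∑ᴾ (allWords n) (λ s q → when (valid s) (f s q)))
  where
  when-∑ᴾ : ∀ b (g : Peg → ℕ) → when b (∑ᴾ g) ≡ ∑ᴾ λ q → when b (g q)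
  when-∑ᴾ true  g = refl
  when-∑ᴾ false g = refl

Σᵛ-suc : ∀ n (f : Word (suc n) → ℕ) →
  Σᵛ (suc n) f ≡ ∑ᴾ λ q → when (allowed (suc n) q) (Σᵛ n λ w → f (q ∷ w))
Σᵛ-suc n f = trans (∑-allWords-suc n _) (∑ᴾ-cong λ q →
  trans (∑-cong (allWords n) (λ w → when-∧ (allowed (suc n) q) (valid w) (f (q ∷ w))))
        (∑-when (allWords n) (allowed (suc n) q) _))

Σᵛ-wordEq : ∀ n (s : Word n) x → Σᵛ n (λ t → when (wordEq s t) x) ≡ when (valid s) x
Σᵛ-wordEq n s x =
  trans (∑-cong (allWords n) (λ t → when-comm (valid t) (wordEq s t) x))
        (∑-wordEq n s (λ t → when (valid t) x))

∑-vertices : ∀ n (f : Word n → ℕ) → ∑ (vertices n) f ≡ Σᵛ n f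
∑-vertices n f = trans (∑-filter _ (allWords n) f)
  (∑-cong (allWords n) (λ s → cong (λ b → when b (f s)) (does-≟-true (valid s))))

edges : ℕ → ℕ
edges n = Σᵛ n λ s → Σᵛ n λ t → 𝟙 (arc s t)

edgeCount≡edges : ∀ n → edgeCount n ≡ edges n
edgeCount≡edges n = begin
  edgeCount n
    ≡⟨ length≡∑ (filter _ (cartesianProduct V V)) ⟩
  ∑ (filter _ (cartesianProduct V V)) (λ _ → 1)
    ≡⟨ trans (∑-filter _ (cartesianProduct V V) (λ _ → 1)) (∑-cartesianProduct V V _) ⟩
  ∑[ s ∈ V ] ∑[ t ∈ V ] 𝟙 (does (arc s t ≟ᵇ true))
    ≡⟨ ∑-cong V (λ s → ∑-cong V (λ t → cong 𝟙 (does-≟-true (arc s t)))) ⟩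
  ∑[ s ∈ V ] ∑[ t ∈ V ] 𝟙 (arc s t)
    ≡⟨ ∑-vertices n _ ⟩
  Σᵛ n (λ s → ∑[ t ∈ V ] 𝟙 (arc s t))
    ≡⟨ Σᵛ-cong n (λ s → ∑-vertices n _) ⟩
  edges n ∎
  where
  open ≡-Reasoning
  V : List (Word n)
  V = vertices n

avoiding : ∀ n → Peg → Peg → ℕ
avoiding n i j = Σᵛ n λ s → 𝟙 (avoids i j s)

-- `allowed d` unfolds to `allowedAt (p d)`: the parity of a disc matters only through r.
allowedAt : Peg → Peg → Bool
allowedAt r q = (q == P0) ∨ (q == r) ∨ (q == P3)

arc-diagonal : ∀ {n} {q q'} (s t : Word n) → (q == q') ≡ true → arc (q ∷ s) (q' ∷ t) ≡ arc s t
arc-diagonal s t q≡q' rewrite q≡q' = refl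

arc-offDiagonal : ∀ {n} {q q'} (s t : Word n) → (q == q') ≡ false →
  arc (q ∷ s) (q' ∷ t) ≡ ((q <ᵇ q') ∧ allowed (suc n) q ∧ allowed (suc n) q') ∧ (wordEq s t ∧ avoids q q' s)
arc-offDiagonal {n} {q} {q'} s t q≢q' rewrite q≢q' =
  sym (trans (∧-assoc (q <ᵇ q') _ _) (cong ((q <ᵇ q') ∧_) (∧-assoc (allowed (suc n) q) _ _)))

edgesBetween : ∀ n → Peg → Peg → ℕ
edgesBetween n q q' = Σᵛ n λ s → Σᵛ n λ t → 𝟙 (arc (q ∷ s) (q' ∷ t))

blockEdges : Peg → ℕ → (Peg → Peg → ℕ) → Peg → Peg → ℕ
blockEdges r e a q q' =
  if q == q' then e else when ((q <ᵇ q') ∧ allowedAt r q ∧ allowedAt r q') (a q q')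

edgesBetween-diagonal : ∀ n {q q'} → (q == q') ≡ true → edgesBetween n q q' ≡ edges n
edgesBetween-diagonal n q≡q' =
  Σᵛ-cong n (λ s → Σᵛ-cong n (λ t → cong 𝟙 (arc-diagonal s t q≡q')))

edgesBetween-offDiagonal : ∀ n {q q'} → (q == q') ≡ false →
  edgesBetween n q q' ≡ when ((q <ᵇ q') ∧ allowed (suc n) q ∧ allowed (suc n) q') (avoiding n q q')
edgesBetween-offDiagonal n {q} {q'} q≢q' = begin
  edgesBetween n q q'
    ≡⟨ Σᵛ-cong n (λ s → Σᵛ-cong n (λ t → move s t)) ⟩
  (Σᵛ n λ s → Σᵛ n λ t → when c (when (wordEq s t) (𝟙 (avoids q q' s))))
    ≡⟨ Σᵛ-cong n (λ s → Σᵛ-when n c _) ⟩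
  (Σᵛ n λ s → when c (Σᵛ n λ t → when (wordEq s t) (𝟙 (avoids q q' s))))
    ≡⟨ Σᵛ-when n c _ ⟩
  when c (Σᵛ n λ s → Σᵛ n λ t → when (wordEq s t) (𝟙 (avoids q q' s)))
    ≡⟨ cong (when c) (∑-cong (allWords n) λ s →
         trans (cong (when (valid s)) (Σᵛ-wordEq n s _)) (when-idem (valid s) _)) ⟩
  when c (avoiding n q q') ∎
  where
  open ≡-Reasoning
  c : Bool
  c = (q <ᵇ q') ∧ allowed (suc n) q ∧ allowed (suc n) q'
  move : ∀ s t → 𝟙 (arc (q ∷ s) (q' ∷ t)) ≡ when c (when (wordEq s t) (𝟙 (avoids q q' s)))
  move s t = begin
    𝟙 (arc (q ∷ s) (q' ∷ t))                   ≡⟨ cong 𝟙 (arc-offDiagonal {n} s t q≢q') ⟩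
    when (c ∧ (wordEq s t ∧ avoids q q' s)) 1  ≡⟨ when-∧ c _ 1 ⟩
    when c (when (wordEq s t ∧ avoids q q' s) 1) ≡⟨ cong (when c) (when-∧ (wordEq s t) _ 1) ⟩
    when c (when (wordEq s t) (𝟙 (avoids q q' s))) ∎

edgesBetween≡blockEdges : ∀ n q q' → edgesBetween n q q' ≡ blockEdges (p (suc n)) (edges n) (avoiding n) q q'
edgesBetween≡blockEdges n q q' = byCase (q == q') refl
  where
  offDiagonal : ℕ
  offDiagonal = when ((q <ᵇ q') ∧ allowed (suc n) q ∧ allowed (suc n) q') (avoiding n q q')
  byCase : ∀ b → (q == q') ≡ b → edgesBetween n q q' ≡ (if b then edges n else offDiagonal)
  byCase true  eq = edgesBetween-diagonal n eq
  byCase false eq = edgesBetween-offDiagonal n eq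

blockSum : Peg → ℕ → (Peg → Peg → ℕ) → ℕ
blockSum r e a = ∑ᴾ λ q → when (allowedAt r q) (∑ᴾ λ q' → when (allowedAt r q') (blockEdges r e a q q'))

edges-suc-blocks : ∀ n → edges (suc n) ≡ blockSum (p (suc n)) (edges n) (avoiding n)
edges-suc-blocks n = begin
  edges (suc n)
    ≡⟨ Σᵛ-suc n (λ s → Σᵛ (suc n) λ t → 𝟙 (arc s t)) ⟩
  (∑ᴾ λ q → when (al q) (Σᵛ n λ s → Σᵛ (suc n) λ t → 𝟙 (arc (q ∷ s) t)))
    ≡⟨ ∑ᴾ-cong (λ q → cong (when (al q)) (Σᵛ-cong n (λ s → Σᵛ-suc n (λ t → 𝟙 (arc (q ∷ s) t))))) ⟩
  (∑ᴾ λ q → when (al q) (Σᵛ n λ s → ∑ᴾ λ q' → when (al q') (edgesFrom q s q')))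
    ≡⟨ ∑ᴾ-cong (λ q → cong (when (al q)) (Σᵛ-∑ᴾ n (λ s q' → when (al q') (edgesFrom q s q')))) ⟩
  (∑ᴾ λ q → when (al q) (∑ᴾ λ q' → Σᵛ n λ s → when (al q') (edgesFrom q s q')))
    ≡⟨ ∑ᴾ-cong (λ q → cong (when (al q)) (∑ᴾ-cong (λ q' → Σᵛ-when n (al q') (λ s → edgesFrom q s q')))) ⟩
  (∑ᴾ λ q → when (al q) (∑ᴾ λ q' → when (al q') (edgesBetween n q q')))
    ≡⟨ ∑ᴾ-cong (λ q → cong (when (al q)) (∑ᴾ-cong (λ q' →
         cong (when (al q')) (edgesBetween≡blockEdges n q q')))) ⟩
  blockSum (p (suc n)) (edges n) (avoiding n) ∎
  where
  open ≡-Reasoning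
  al : Peg → Bool
  al = allowed (suc n)
  edgesFrom : Peg → Word n → Peg → ℕ
  edgesFrom q s q' = Σᵛ n λ t → 𝟙 (arc (q ∷ s) (q' ∷ t))

blockSum-reserved : ∀ {r} → r ≡ P1 ⊎ r ≡ P2 → ∀ e (a : Peg → Peg → ℕ) →
  blockSum r e a ≡ 3 * e + (a P0 r + a P0 P3 + a r P3)
blockSum-reserved {r} r∈ e a = trans (rows r∈) (collect e (a P0 r) (a P0 P3) (a r P3))
  where
  rows : r ≡ P1 ⊎ r ≡ P2 → blockSum r e a ≡ e + (a P0 r + a P0 P3) + (e + a r P3 + e)
  rows (inj₁ refl) = refl
  rows (inj₂ refl) = refl
  collect : ∀ e u v w → e + (u + v) + (e + w + e) ≡ 3 * e + (u + v + w)
  collect = solve-∀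

p-reserved : ∀ d → p d ≡ P1 ⊎ p d ≡ P2
p-reserved d with isEven d
... | true  = inj₁ refl
... | false = inj₂ refl

largestDiscMoves : ℕ → Peg → ℕ
largestDiscMoves n r = avoiding n P0 r + avoiding n P0 P3 + avoiding n r P3

edges-suc : ∀ n → edges (suc n) ≡ 3 * edges n + largestDiscMoves n (p (suc n))
edges-suc n = trans (edges-suc-blocks n) (blockSum-reserved (p-reserved (suc n)) (edges n) (avoiding n))

freePegs : Peg → Peg → Peg → ℕ
freePegs r i j = ∑ᴾ λ q → 𝟙 (allowedAt r q ∧ not (q == i) ∧ not (q == j))

avoiding-suc : ∀ n i j → avoiding (suc n) i j ≡ freePegs (p (suc n)) i j * avoiding n i j
avoiding-suc n i j = begin
  avoiding (suc n) i j
    ≡⟨ Σᵛ-suc n (λ s → 𝟙 (avoids i j s)) ⟩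
  (∑ᴾ λ q → when (al q) (Σᵛ n λ w → 𝟙 (not (q == i) ∧ not (q == j) ∧ avoids i j w)))
    ≡⟨ ∑ᴾ-cong (λ q → cong (when (al q)) (peel q)) ⟩
  (∑ᴾ λ q → when (al q) (when (not (q == i)) (when (not (q == j)) (avoiding n i j))))
    ≡⟨ ∑ᴾ-cong (λ q → sym (when-∧₃ (al q) (not (q == i)) (not (q == j)) (avoiding n i j))) ⟩
  (∑ᴾ λ q → when (al q ∧ not (q == i) ∧ not (q == j)) (avoiding n i j))
    ≡⟨ ∑ᴾ-when-const (λ q → al q ∧ not (q == i) ∧ not (q == j)) (avoiding n i j) ⟩
  freePegs (p (suc n)) i j * avoiding n i j ∎
  where
  open ≡-Reasoning
  al : Peg → Bool
  al = allowed (suc n)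
  peel : ∀ q → (Σᵛ n λ w → 𝟙 (not (q == i) ∧ not (q == j) ∧ avoids i j w))
             ≡ when (not (q == i)) (when (not (q == j)) (avoiding n i j))
  peel q = begin
    (Σᵛ n λ w → 𝟙 (not (q == i) ∧ not (q == j) ∧ avoids i j w))
      ≡⟨ Σᵛ-cong n (λ w → when-∧₃ (not (q == i)) (not (q == j)) (avoids i j w) 1) ⟩
    (Σᵛ n λ w → when (not (q == i)) (when (not (q == j)) (𝟙 (avoids i j w))))
      ≡⟨ trans (Σᵛ-when n _ _) (cong (when (not (q == i))) (Σᵛ-when n _ _)) ⟩
    when (not (q == i)) (when (not (q == j)) (avoiding n i j)) ∎

avoiding-step : ∀ n i j {r x} → p (suc n) ≡ r → avoiding n i j ≡ x → avoiding (suc n) i j ≡ freePegs r i j * x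
avoiding-step n i j p≡r hx = trans (avoiding-suc n i j) (cong₂ _*_ (cong (λ r → freePegs r i j) p≡r) hx)

edges-tripling : ∀ e d c {e' c' t} → e' ≡ 3 * e + d → 14 * d + c' ≡ 3 * c + 14 →
  14 * e + c + 7 ≡ t → 14 * e' + c' + 7 ≡ 3 * t
edges-tripling e d c {e'} {c'} {t} e'≡ dc e≡ = begin
  14 * e' + c' + 7                 ≡⟨ cong (λ z → 14 * z + c' + 7) e'≡ ⟩
  14 * (3 * e + d) + c' + 7        ≡⟨ split e d c' ⟩
  3 * (14 * e) + (14 * d + c') + 7 ≡⟨ cong (λ z → 3 * (14 * e) + z + 7) dc ⟩
  3 * (14 * e) + (3 * c + 14) + 7  ≡⟨ merge e c ⟩
  3 * (14 * e + c + 7)             ≡⟨ cong (3 *_) e≡ ⟩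
  3 * t                            ∎
  where
  open ≡-Reasoning
  split : ∀ e d c' → 14 * (3 * e + d) + c' + 7 ≡ 3 * (14 * e) + (14 * d + c') + 7
  split = solve-∀
  merge : ∀ e c → 3 * (14 * e) + (3 * c + 14) + 7 ≡ 3 * (14 * e + c + 7)
  merge = solve-∀

record Counts (n c x y : ℕ) : Set where
  field
    edges≡   : 14 * edges n + c + 7 ≡ 3 ^ (n + 3)
    avoid01≡ : avoiding n P0 P1 ≡ x
    avoid13≡ : avoiding n P1 P3 ≡ x
    avoid02≡ : avoiding n P0 P2 ≡ y
    avoid23≡ : avoiding n P2 P3 ≡ y
    avoid03≡ : avoiding n P0 P3 ≡ 1

counts-odd-disc : ∀ {n x} → p (suc n) ≡ P2 → Counts n (20 * x) x x → Counts (suc n) (32 * x) (2 * x) x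
counts-odd-disc {n} {x} p≡P2 cs = record
  { edges≡   = edges-tripling (edges n) (x + 1 + x) (20 * x) edges-step (arith x) edges≡
  ; avoid01≡ = avoiding-step n P0 P1 p≡P2 avoid01≡
  ; avoid13≡ = avoiding-step n P1 P3 p≡P2 avoid13≡
  ; avoid02≡ = trans (avoiding-step n P0 P2 p≡P2 avoid02≡) (*-identityˡ x)
  ; avoid23≡ = trans (avoiding-step n P2 P3 p≡P2 avoid23≡) (*-identityˡ x)
  ; avoid03≡ = avoiding-step n P0 P3 p≡P2 avoid03≡
  }
  where
  open Counts cs
  edges-step : edges (suc n) ≡ 3 * edges n + (x + 1 + x)
  edges-step = trans (edges-suc n) (cong (3 * edges n +_)
    (trans (cong (largestDiscMoves n) p≡P2) (cong₂ _+_ (cong₂ _+_ avoid02≡ avoid03≡) avoid23≡)))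
  arith : ∀ x → 14 * (x + 1 + x) + 32 * x ≡ 3 * (20 * x) + 14
  arith = solve-∀

counts-even-disc : ∀ {n x} → p (suc n) ≡ P1 → Counts n (32 * x) (2 * x) x →
  Counts (suc n) (20 * (2 * x)) (2 * x) (2 * x)
counts-even-disc {n} {x} p≡P1 cs = record
  { edges≡   = edges-tripling (edges n) (2 * x + 1 + 2 * x) (32 * x) edges-step (arith x) edges≡
  ; avoid01≡ = trans (avoiding-step n P0 P1 p≡P1 avoid01≡) (*-identityˡ (2 * x))
  ; avoid13≡ = trans (avoiding-step n P1 P3 p≡P1 avoid13≡) (*-identityˡ (2 * x))
  ; avoid02≡ = avoiding-step n P0 P2 p≡P1 avoid02≡
  ; avoid23≡ = avoiding-step n P2 P3 p≡P1 avoid23≡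
  ; avoid03≡ = avoiding-step n P0 P3 p≡P1 avoid03≡
  }
  where
  open Counts cs
  edges-step : edges (suc n) ≡ 3 * edges n + (2 * x + 1 + 2 * x)
  edges-step = trans (edges-suc n) (cong (3 * edges n +_)
    (trans (cong (largestDiscMoves n) p≡P1) (cong₂ _+_ (cong₂ _+_ avoid01≡ avoid03≡) avoid13≡)))
  arith : ∀ x → 14 * (2 * x + 1 + 2 * x) + 20 * (2 * x) ≡ 3 * (32 * x) + 14
  arith = solve-∀

isEven-double : ∀ k → isEven (2 * k) ≡ true
isEven-double zero = refl
isEven-double (suc k) =
  trans (cong isEven (*-suc 2 k)) (trans (not-involutive (isEven (2 * k))) (isEven-double k))

p-odd : ∀ k → p (suc (2 * k)) ≡ P2
p-odd k = cong (λ b → if not b then P1 else P2) (isEven-double k)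

p-even : ∀ k → p (suc (suc (2 * k))) ≡ P1
p-even k = cong (λ b → if b then P1 else P2) (trans (not-involutive (isEven (2 * k))) (isEven-double k))

counts-even : ∀ k → Counts (2 * k) (20 * 2 ^ k) (2 ^ k) (2 ^ k)
counts-odd  : ∀ k → Counts (suc (2 * k)) (32 * 2 ^ k) (2 * 2 ^ k) (2 ^ k)

counts-even zero    = record { edges≡ = refl ; avoid01≡ = refl ; avoid13≡ = refl
                             ; avoid02≡ = refl ; avoid23≡ = refl ; avoid03≡ = refl }
counts-even (suc k) = subst (λ n → Counts n (20 * 2 ^ suc k) (2 ^ suc k) (2 ^ suc k)) (sym (*-suc 2 k))
  (counts-even-disc (p-even k) (counts-odd k))

counts-odd k = counts-odd-disc (p-odd k) (counts-even k)

edgeCount-formula : ∀ {n c x y} → Counts n c x y → 14 * edgeCount n + c + 7 ≡ 3 ^ (n + 3)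
edgeCount-formula {n} {c} cs = trans (cong (λ e → 14 * e + c + 7) (edgeCount≡edges n)) (Counts.edges≡ cs)

proposition6p3 : (k : ℕ) →
    (14 * edgeCount (2 * k) + 20 * 2 ^ k + 7 ≡ 3 ^ (2 * k + 3))
    × (14 * edgeCount (2 * k + 1) + 32 * 2 ^ k + 7 ≡ 3 ^ (2 * k + 1 + 3))
proposition6p3 k =
    edgeCount-formula (counts-even k)
  , subst (λ n → 14 * edgeCount n + 32 * 2 ^ k + 7 ≡ 3 ^ (n + 3)) (+-comm 1 (2 * k))
      (edgeCount-formula (counts-odd k))
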